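{- There exists a computable function $\varphi:\mathbb{N}\times\mathbb{N}\to\mathbb{N}$ satisfying: (1) for all non-negative integers $n,l$, $\varphi(n,l)\leq l$; (2) for each non-negative integer $n$, $0=\varphi(n,0)<1=\varphi(n,1)\leq\varphi(n,2)\leq\varphi(n,3)\leq\ldots$; (3) for each non-negative integer $n$, the sequence $\{\varphi(n,l)\}_{l\in\mathbb{N}}$ is bounded from above; (4) the function $\theta:\mathbb{N}\to\mathbb{N}\setminus\{0\}$, $\theta(n)=\lim_{l\to\infty}\varphi(n,l)$, is strictly increasing and dominates all computable functions; (5) for each non-negative integer $n$, $\varphi(n,\theta(n)-1)<\theta(n)=\varphi(n,\theta(n))=\varphi(n,\theta(n)+1)=\varphi(n,\theta(n)+2)=\ldots$.
   Context: $\mathbb{N}$ denotes the set of non-negative integers. A function $\theta:\mathbb{N}\to\mathbb{N}$ dominates all computable functions if for every computable function $\Gamma:\mathbb{N}\to\mathbb{N}$ there exists $m\in\mathbb{N}$ such that $\Gamma(n)<\theta(n)$ for all $n\geq m$. -}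

module Defs where

open import Data.Nat using (ℕ; zero; suc; _≤_; _<_)
open import Data.Fin using (Fin)
open import Data.Vec using (Vec; []; _∷_; lookup)
open import Data.Product using (Σ; ∃; _×_)
open import Relation.Binary.PropositionalEquality using (_≡_)

-- Codes of partial recursive (μ-recursive) functions of arity k.
data PR : ℕ → Set where
  zeroF : PR 1
  succF : PR 1
  proj  : ∀ {k} → Fin k → PR k
  comp  : ∀ {k m} → PR m → Vec (PR k) m → PR k
  prim  : ∀ {k} → PR k → PR (suc (suc k)) → PR (suc k)
                                                 -- h(0,xs)=f(xs), h(n+1,xs)=g(n,h(n,xs),xs)
  mu    : ∀ {k} → PR (suc k) → PR k              -- least n with f(n,xs)=0 (all earlier defined)

mutual
  data Eval : ∀ {k} → PR k → Vec ℕ k → ℕ → Set where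
    ev-zero : ∀ {x} → Eval zeroF (x ∷ []) 0
    ev-succ : ∀ {x} → Eval succF (x ∷ []) (suc x)
    ev-proj : ∀ {k} {i : Fin k} {xs} → Eval (proj i) xs (lookup xs i)
    ev-comp : ∀ {k m} {f : PR m} {gs : Vec (PR k) m} {xs ys v} →
              EvalAll gs xs ys → Eval f ys v → Eval (comp f gs) xs v
    ev-prim0 : ∀ {k} {f : PR k} {g} {xs v} →
               Eval f xs v → Eval (prim f g) (0 ∷ xs) v
    ev-primS : ∀ {k} {f : PR k} {g} {n xs r v} →
               Eval (prim f g) (n ∷ xs) r → Eval g (n ∷ r ∷ xs) v →
               Eval (prim f g) (suc n ∷ xs) v
    ev-mu : ∀ {k} {f : PR (suc k)} {xs n} →
            Eval f (n ∷ xs) 0 →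
            (∀ i → i < n → Σ ℕ (λ v → Eval f (i ∷ xs) (suc v))) →
            Eval (mu f) xs n

  data EvalAll : ∀ {k m} → Vec (PR k) m → Vec ℕ k → Vec ℕ m → Set where
    ea-[] : ∀ {k} {xs : Vec ℕ k} → EvalAll [] xs []
    ea-∷  : ∀ {k m} {g : PR k} {gs : Vec (PR k) m} {xs y ys} →
            Eval g xs y → EvalAll gs xs ys → EvalAll (g ∷ gs) xs (y ∷ ys)

Computable₁ : (ℕ → ℕ) → Set
Computable₁ Γ = Σ (PR 1) (λ c → ∀ n → Eval c (n ∷ []) (Γ n))

Computable₂ : (ℕ → ℕ → ℕ) → Set
Computable₂ φ = Σ (PR 2) (λ c → ∀ n l → Eval c (n ∷ l ∷ []) (φ n l))

DominatesComputable : (ℕ → ℕ) → Set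
DominatesComputable θ =
  ∀ Γ → Computable₁ Γ → ∃ (λ m → ∀ n → m ≤ n → Γ n < θ n)

IsLimit : (ℕ → ℕ) → ℕ → Set
IsLimit s a = ∃ (λ L → ∀ l → L ≤ l → s l ≡ a)

StrictlyIncreasing : (ℕ → ℕ) → Set
StrictlyIncreasing θ = ∀ m n → m < n → θ m < θ n

module Submission where

-- Fix a universal machine for partial recursive codes and let  lim e x  be
-- "halting time + output" of program e on input x (0 if it diverges; excluded middle
-- is needed only to pick this value).  If Γ is computed by code c, then
-- Γ n ≤ lim (code c) n, so  θ n = 1 + n + Σ_{e,x ≤ n} lim e x  dominates Γ from n = code c
-- on, and θ is strictly increasing.  Running the machine for l steps gives a computable
-- approximation  approx e x l  which is monotone in l, bounded by lim e x, and equal to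
-- it from stage lim e x on (because the halting time is counted in lim).  Replacing lim
-- by approx in θ gives ψ n l, and  φ n l = min(l, ψ n l)  has all required properties.

open import Defs
open import Level using (0ℓ)
open import Axiom.ExcludedMiddle using (ExcludedMiddle)
open import Data.Nat using (ℕ; zero; suc; _≤_; _<_; _∸_)
open import Data.Product using (Σ; ∃; _×_)
open import Relation.Binary.PropositionalEquality using (_≡_)

open import Data.Nat using (_+_; z≤n; s≤s; pred; _⊓_)
open import Data.Nat.Properties
open import Data.Fin using (Fin; toℕ) renaming (zero to fz; suc to fs)
open import Data.Vec using (Vec; []; _∷_; lookup)
open import Data.Product using (_,_; proj₁; proj₂)
open import Data.Sum using (_⊎_; inj₁; inj₂)
open import Data.Empty using (⊥-elim)
open import Relation.Nullary using (¬_; yes; no)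
open import Relation.Binary.PropositionalEquality using (refl; sym; trans; cong; cong₂; subst)
open import Relation.Binary.Definitions using (tri<; tri≈; tri>)

Comp : (k : ℕ) → (Vec ℕ k → ℕ) → Set
Comp k f = Σ (PR k) (λ c → ∀ xs → Eval c xs (f xs))

comp-ext : ∀ {k f g} → Comp k f → (∀ xs → f xs ≡ g xs) → Comp k g
comp-ext (c , p) e = c , λ xs → subst (Eval c xs) (e xs) (p xs)

proj-comp : ∀ {k} (i : Fin k) → Comp k (λ xs → lookup xs i)
proj-comp i = proj i , λ xs → ev-proj

-- Nullary numerals: 0 is the least root of the zero function, n+1 is a successor.
numeral : ℕ → PR 0
numeral zero = mu zeroF
numeral (suc n) = comp succF (numeral n ∷ [])

numeral-eval : ∀ n → Eval (numeral n) [] n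
numeral-eval zero = ev-mu ev-zero (λ i ())
numeral-eval (suc n) = ev-comp (ea-∷ (numeral-eval n) ea-[]) ev-succ

primRec : ∀ {k} → (Vec ℕ k → ℕ) → (Vec ℕ (suc (suc k)) → ℕ) → Vec ℕ (suc k) → ℕ
primRec f g (zero ∷ xs) = f xs
primRec f g (suc n ∷ xs) = g (n ∷ primRec f g (n ∷ xs) ∷ xs)

prim-comp : ∀ {k f g} → Comp k f → Comp (suc (suc k)) g → Comp (suc k) (primRec f g)
prim-comp {k} {f} {g} (cf , pf) (cg , pg) = prim cf cg , eval-prim
  where
  eval-prim : ∀ xs → Eval (prim cf cg) xs (primRec f g xs)
  eval-prim (zero ∷ xs) = ev-prim0 (pf xs)
  eval-prim (suc n ∷ xs) = ev-primS (eval-prim (n ∷ xs)) (pg _)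

-- Expressions in k variables built from numerals and already computable functions;
-- they compile to codes, so anything written as an expression is computable.
data Expr (k : ℕ) : Set where
  var : Fin k → Expr k
  lit : ℕ → Expr k
  app : ∀ {m} {F : Vec ℕ m → ℕ} → Comp m F → Vec (Expr k) m → Expr k

mutual
  evalE : ∀ {k} → Expr k → Vec ℕ k → ℕ
  evalE (var i) ρ = lookup ρ i
  evalE (lit n) ρ = n
  evalE (app {F = F} c as) ρ = F (evalEs as ρ)

  evalEs : ∀ {k m} → Vec (Expr k) m → Vec ℕ k → Vec ℕ m
  evalEs [] ρ = []
  evalEs (a ∷ as) ρ = evalE a ρ ∷ evalEs as ρ

mutual
  compile : ∀ {k} → Expr k → PR k
  compile (var i) = proj i
  compile (lit n) = comp (numeral n) []
  compile (app c as) = comp (proj₁ c) (compileAll as)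

  compileAll : ∀ {k m} → Vec (Expr k) m → Vec (PR k) m
  compileAll [] = []
  compileAll (a ∷ as) = compile a ∷ compileAll as

mutual
  compile-eval : ∀ {k} (e : Expr k) ρ → Eval (compile e) ρ (evalE e ρ)
  compile-eval (var i) ρ = ev-proj
  compile-eval (lit n) ρ = ev-comp ea-[] (numeral-eval n)
  compile-eval (app c as) ρ = ev-comp (compileAll-eval as ρ) (proj₂ c _)

  compileAll-eval : ∀ {k m} (as : Vec (Expr k) m) ρ → EvalAll (compileAll as) ρ (evalEs as ρ)
  compileAll-eval [] ρ = ea-[]
  compileAll-eval (a ∷ as) ρ = ea-∷ (compile-eval a ρ) (compileAll-eval as ρ)

-- Curried k-ary functions; stating computability of  uncurryⁿ h  lets an
-- application  app c (a ∷ …)  evaluate definitionally to  h (evalE a ρ) ….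
Fun : ℕ → Set
Fun zero = ℕ
Fun (suc k) = ℕ → Fun k

uncurryⁿ : ∀ {k} → Fun k → Vec ℕ k → ℕ
uncurryⁿ f [] = f
uncurryⁿ f (x ∷ xs) = uncurryⁿ (f x) xs

curryⁿ : ∀ {k} → (Vec ℕ k → ℕ) → Fun k
curryⁿ {zero} f = f []
curryⁿ {suc k} f = λ x → curryⁿ (λ xs → f (x ∷ xs))

uncurry-curry : ∀ {k} (f : Vec ℕ k → ℕ) xs → f xs ≡ uncurryⁿ (curryⁿ f) xs
uncurry-curry f [] = refl
uncurry-curry f (x ∷ xs) = uncurry-curry (λ ys → f (x ∷ ys)) xs

expr-comp : ∀ {k} (e : Expr k) → Comp k (uncurryⁿ (curryⁿ (evalE e)))
expr-comp e = comp-ext (compile e , compile-eval e) (uncurry-curry (evalE e))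

comp-via : ∀ {k} (h : Fun k) (e : Expr k) → (∀ xs → evalE e xs ≡ uncurryⁿ h xs) → Comp k (uncurryⁿ h)
comp-via h e p = comp-ext (compile e , compile-eval e) p

#0 : ∀ {k} → Expr (suc k)
#0 = var fz
#1 : ∀ {k} → Expr (suc (suc k))
#1 = var (fs fz)
#2 : ∀ {k} → Expr (suc (suc (suc k)))
#2 = var (fs (fs fz))
#3 : ∀ {k} → Expr (suc (suc (suc (suc k))))
#3 = var (fs (fs (fs fz)))
#4 : ∀ {k} → Expr (suc (suc (suc (suc (suc k)))))
#4 = var (fs (fs (fs (fs fz))))
#5 : ∀ {k} → Expr (suc (suc (suc (suc (suc (suc k))))))
#5 = var (fs (fs (fs (fs (fs fz)))))
#6 : ∀ {k} → Expr (suc (suc (suc (suc (suc (suc (suc k)))))))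
#6 = var (fs (fs (fs (fs (fs (fs fz))))))

ap1 : ∀ {k} {h : Fun 1} → Comp 1 (uncurryⁿ h) → Expr k → Expr k
ap1 c a = app c (a ∷ [])
ap2 : ∀ {k} {h : Fun 2} → Comp 2 (uncurryⁿ h) → Expr k → Expr k → Expr k
ap2 c a b = app c (a ∷ b ∷ [])
ap3 : ∀ {k} {h : Fun 3} → Comp 3 (uncurryⁿ h) → Expr k → Expr k → Expr k → Expr k
ap3 c a b d = app c (a ∷ b ∷ d ∷ [])

succC : Comp 1 (uncurryⁿ suc)
succC = succF , λ { (x ∷ []) → ev-succ }

predC : Comp 1 (uncurryⁿ pred)
predC = comp-ext (prim-comp (expr-comp {0} (lit 0)) (proj-comp fz))
  λ { (zero ∷ []) → refl ; (suc n ∷ []) → refl }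

addC : Comp 2 (uncurryⁿ _+_)
addC = comp-ext (prim-comp (proj-comp fz) (expr-comp (ap1 succC #1))) add-eq
  where
  add-eq : ∀ xs → _ ≡ _
  add-eq (zero ∷ b ∷ []) = refl
  add-eq (suc a ∷ b ∷ []) = cong suc (add-eq (a ∷ b ∷ []))

-- Recursion on the subtrahend computes  (b , a) ↦ a ∸ b ; swapping gives _∸_.
flipSubC : Comp 2 (λ xs → lookup xs (fs fz) ∸ lookup xs fz)
flipSubC = comp-ext (prim-comp (proj-comp fz) (expr-comp (ap1 predC #1))) sub-eq
  where
  sub-eq : ∀ xs → _ ≡ _
  sub-eq (zero ∷ a ∷ []) = refl
  sub-eq (suc b ∷ a ∷ []) = trans (cong pred (sub-eq (b ∷ a ∷ []))) (pred[m∸n]≡m∸[1+n] a b)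

subC : Comp 2 (uncurryⁿ _∸_)
subC = comp-via _∸_ (app flipSubC (#1 ∷ #0 ∷ [])) λ { (a ∷ b ∷ []) → refl }

ifz : ℕ → ℕ → ℕ → ℕ
ifz zero a b = a
ifz (suc _) a b = b

ifzC : Comp 3 (uncurryⁿ ifz)
ifzC = comp-ext (prim-comp (proj-comp fz) (proj-comp (fs (fs (fs fz)))))
  λ { (zero ∷ a ∷ b ∷ []) → refl ; (suc n ∷ a ∷ b ∷ []) → refl }

-- The distance |a − b|, which vanishes exactly on equal arguments: a computable equality test.
dist : ℕ → ℕ → ℕ
dist a b = (a ∸ b) + (b ∸ a)

distC : Comp 2 (uncurryⁿ dist)
distC = comp-via dist (ap2 addC (ap2 subC #0 #1) (ap2 subC #1 #0)) λ { (a ∷ b ∷ []) → refl }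

dist-self : ∀ n → dist n n ≡ 0
dist-self n rewrite n∸n≡0 n = refl

dist≡0⇒≡ : ∀ a b → dist a b ≡ 0 → a ≡ b
dist≡0⇒≡ a b e = ≤-antisym (m∸n≡0⇒m≤n (m+n≡0⇒m≡0 (a ∸ b) e)) (m∸n≡0⇒m≤n (m+n≡0⇒n≡0 (a ∸ b) e))

ifz-dist-≢ : ∀ a b x y → ¬ (a ≡ b) → ifz (dist a b) x y ≡ y
ifz-dist-≢ a b x y a≢b with dist a b in eq
... | zero = ⊥-elim (a≢b (dist≡0⇒≡ a b eq))
... | suc _ = refl

-- Cantor pairing  pair a b = tri (a + b) + b  with computable inverses; kept opaque so
-- that large encoded terms are never unfolded during type checking.
opaque
  tri : ℕ → ℕ
  tri zero = 0
  tri (suc s) = suc s + tri s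

  triC : Comp 1 (uncurryⁿ tri)
  triC = comp-ext (prim-comp (expr-comp (lit 0)) (expr-comp recStep)) tri-eq
    where
    recStep : Expr 2
    recStep = ap2 addC (ap1 succC #0) #1
    tri-eq : ∀ (xs : Vec ℕ 1) →
      primRec (uncurryⁿ (curryⁿ (evalE {0} (lit 0)))) (uncurryⁿ (curryⁿ (evalE recStep))) xs ≡ uncurryⁿ tri xs
    tri-eq (zero ∷ []) = refl
    tri-eq (suc s ∷ []) = cong (suc s +_) (tri-eq (s ∷ []))

  -- root z is the largest s with tri s ≤ z, computed by recursion on z.
  root : ℕ → ℕ
  root zero = 0
  root (suc z) = ifz (tri (suc (root z)) ∸ suc z) (suc (root z)) (root z)

  rootC : Comp 1 (uncurryⁿ root)
  rootC = comp-ext (prim-comp (expr-comp (lit 0)) (expr-comp recStep)) root-eq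
    where
    recStep : Expr 2
    recStep = ap3 ifzC (ap2 subC (ap1 triC (ap1 succC #1)) (ap1 succC #0)) (ap1 succC #1) #1
    root-eq : ∀ (xs : Vec ℕ 1) →
      primRec (uncurryⁿ (curryⁿ (evalE {0} (lit 0)))) (uncurryⁿ (curryⁿ (evalE recStep))) xs ≡ uncurryⁿ root xs
    root-eq (zero ∷ []) = refl
    root-eq (suc z ∷ []) rewrite root-eq (z ∷ []) = refl

  pair : ℕ → ℕ → ℕ
  pair a b = tri (a + b) + b

  snd : ℕ → ℕ
  snd z = z ∸ tri (root z)

  fst : ℕ → ℕ
  fst z = root z ∸ snd z

  pairC : Comp 2 (uncurryⁿ pair)
  pairC = comp-via pair (ap2 addC (ap1 triC (ap2 addC #0 #1)) #1) λ { (a ∷ b ∷ []) → refl }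

  sndC : Comp 1 (uncurryⁿ snd)
  sndC = comp-via snd (ap2 subC #0 (ap1 triC (ap1 rootC #0))) λ { (a ∷ []) → refl }

  fstC : Comp 1 (uncurryⁿ fst)
  fstC = comp-via fst (ap2 subC (ap1 rootC #0) (ap1 sndC #0)) λ { (a ∷ []) → refl }

  root-spec : ∀ z → tri (root z) ≤ z × z < tri (suc (root z))
  root-spec zero = z≤n , s≤s z≤n
  root-spec (suc z) with root-spec z | tri (suc (root z)) ∸ suc z in eq
  ... | (lower , upper) | zero =
    m∸n≡0⇒m≤n eq , ≤-trans (s≤s upper) (s≤s (m≤n+m (tri (suc (root z))) (suc (root z))))
  ... | (lower , upper) | suc _ = m≤n⇒m≤1+n lower , m∸n≢0⇒n<m (λ e → 0≢1+n (trans (sym e) eq))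

  tri-mono : ∀ {s t} → s ≤ t → tri s ≤ tri t
  tri-mono {zero} {t} p = z≤n
  tri-mono {suc s} {suc t} (s≤s p) = +-mono-≤ (s≤s p) (tri-mono p)

  -- The intervals [tri s, tri (s+1)) are disjoint, so the root is unique.
  root-unique : ∀ s t z → tri s ≤ z → z < tri (suc s) → tri t ≤ z → z < tri (suc t) → s ≡ t
  root-unique s t z lo-s hi-s lo-t hi-t with <-cmp s t
  ... | tri≈ _ e _ = e
  ... | tri< s<t _ _ = ⊥-elim (<⇒≱ hi-s (≤-trans (tri-mono s<t) lo-t))
  ... | tri> _ _ t<s = ⊥-elim (<⇒≱ hi-t (≤-trans (tri-mono t<s) lo-s))

  root-pair : ∀ a b → root (pair a b) ≡ a + b
  root-pair a b = sym (root-unique (a + b) (root (pair a b)) (pair a b)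
    (m≤m+n (tri (a + b)) b) upper (proj₁ (root-spec (pair a b))) (proj₂ (root-spec (pair a b))))
    where
    open ≤-Reasoning
    upper : pair a b < tri (suc (a + b))
    upper = begin-strict
      tri (a + b) + b         <⟨ +-monoʳ-< (tri (a + b)) (s≤s (m≤n+m b a)) ⟩
      tri (a + b) + suc (a + b) ≡⟨ +-comm (tri (a + b)) (suc (a + b)) ⟩
      tri (suc (a + b))       ∎

  snd-pair : ∀ a b → snd (pair a b) ≡ b
  snd-pair a b rewrite root-pair a b = m+n∸m≡n (tri (a + b)) b

  fst-pair : ∀ a b → fst (pair a b) ≡ a
  fst-pair a b rewrite snd-pair a b | root-pair a b = m+n∸n≡m a b

-- Lists of numbers: 0 is the empty list and  cons x l = 1 + pair x l .
cons : ℕ → ℕ → ℕ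
cons x l = suc (pair x l)

hd : ℕ → ℕ
hd l = fst (pred l)

tl : ℕ → ℕ
tl l = snd (pred l)

consC : Comp 2 (uncurryⁿ cons)
consC = comp-via cons (ap1 succC (ap2 pairC #0 #1)) λ { (a ∷ b ∷ []) → refl }

hdC : Comp 1 (uncurryⁿ hd)
hdC = comp-via hd (ap1 fstC (ap1 predC #0)) λ { (a ∷ []) → refl }

tlC : Comp 1 (uncurryⁿ tl)
tlC = comp-via tl (ap1 sndC (ap1 predC #0)) λ { (a ∷ []) → refl }

hd-cons : ∀ x l → hd (cons x l) ≡ x
hd-cons x l = fst-pair x l

tl-cons : ∀ x l → tl (cons x l) ≡ l
tl-cons x l = snd-pair x l

drop : ℕ → ℕ → ℕ
drop zero l = l
drop (suc i) l = tl (drop i l)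

dropC : Comp 2 (uncurryⁿ drop)
dropC = comp-ext (prim-comp (proj-comp fz) (expr-comp (ap1 tlC #1))) drop-eq
  where
  drop-eq : ∀ xs → _ ≡ _
  drop-eq (zero ∷ l ∷ []) = refl
  drop-eq (suc i ∷ l ∷ []) = cong tl (drop-eq (i ∷ l ∷ []))

drop-suc : ∀ i l → drop (suc i) l ≡ drop i (tl l)
drop-suc zero l = refl
drop-suc (suc i) l = cong tl (drop-suc i l)

nth : ℕ → ℕ → ℕ
nth l i = hd (drop i l)

nthC : Comp 2 (uncurryⁿ nth)
nthC = comp-via nth (ap1 hdC (ap2 dropC #1 #0)) λ { (a ∷ b ∷ []) → refl }

encodeOnto : ∀ {m} → Vec ℕ m → ℕ → ℕ
encodeOnto [] acc = acc
encodeOnto (y ∷ ys) acc = cons y (encodeOnto ys acc)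

encode : ∀ {m} → Vec ℕ m → ℕ
encode xs = encodeOnto xs 0

nth-encode : ∀ {k} (xs : Vec ℕ k) (i : Fin k) → nth (encode xs) (toℕ i) ≡ lookup xs i
nth-encode (x ∷ xs) fz = hd-cons x (encode xs)
nth-encode (x ∷ xs) (fs i) rewrite drop-suc (toℕ i) (cons x (encode xs)) | tl-cons x (encode xs) =
  nth-encode xs i

state : ℕ → ℕ → ℕ → ℕ → ℕ → ℕ → ℕ
state t a b c d e = pair t (pair a (pair b (pair c (pair d e))))

slot0 slot1 slot2 slot3 slot4 slot5 : ℕ → ℕ
slot0 s = fst s
slot1 s = fst (snd s)
slot2 s = fst (snd (snd s))
slot3 s = fst (snd (snd (snd s)))
slot4 s = fst (snd (snd (snd (snd s))))
slot5 s = snd (snd (snd (snd (snd s))))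

module _ (t a b c d e : ℕ) where
  slot0-state : slot0 (state t a b c d e) ≡ t
  slot0-state = fst-pair t _
  slot1-state : slot1 (state t a b c d e) ≡ a
  slot1-state rewrite snd-pair t (pair a (pair b (pair c (pair d e)))) = fst-pair a _
  slot2-state : slot2 (state t a b c d e) ≡ b
  slot2-state rewrite snd-pair t (pair a (pair b (pair c (pair d e))))
                    | snd-pair a (pair b (pair c (pair d e))) = fst-pair b _
  slot3-state : slot3 (state t a b c d e) ≡ c
  slot3-state rewrite snd-pair t (pair a (pair b (pair c (pair d e))))
                    | snd-pair a (pair b (pair c (pair d e)))
                    | snd-pair b (pair c (pair d e)) = fst-pair c _
  slot4-state : slot4 (state t a b c d e) ≡ d
  slot4-state rewrite snd-pair t (pair a (pair b (pair c (pair d e))))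
                    | snd-pair a (pair b (pair c (pair d e)))
                    | snd-pair b (pair c (pair d e))
                    | snd-pair c (pair d e) = fst-pair d _
  slot5-state : slot5 (state t a b c d e) ≡ e
  slot5-state rewrite snd-pair t (pair a (pair b (pair c (pair d e))))
                    | snd-pair a (pair b (pair c (pair d e)))
                    | snd-pair b (pair c (pair d e))
                    | snd-pair c (pair d e) = snd-pair d e

stateC : Comp 6 (uncurryⁿ state)
stateC = comp-via state
  (app pairC (#0 ∷ app pairC (#1 ∷ app pairC (#2 ∷ app pairC (#3 ∷ app pairC (#4 ∷ #5 ∷ []) ∷ []) ∷ []) ∷ []) ∷ []))
  λ { (t ∷ a ∷ b ∷ c ∷ d ∷ e ∷ []) → refl }

slot0C slot1C slot2C slot3C slot4C slot5C : Comp 1 (uncurryⁿ _)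
slot0C = comp-via slot0 (ap1 fstC #0) λ { (a ∷ []) → refl }
slot1C = comp-via slot1 (ap1 fstC (ap1 sndC #0)) λ { (a ∷ []) → refl }
slot2C = comp-via slot2 (ap1 fstC (ap1 sndC (ap1 sndC #0))) λ { (a ∷ []) → refl }
slot3C = comp-via slot3 (ap1 fstC (ap1 sndC (ap1 sndC (ap1 sndC #0)))) λ { (a ∷ []) → refl }
slot4C = comp-via slot4 (ap1 fstC (ap1 sndC (ap1 sndC (ap1 sndC (ap1 sndC #0))))) λ { (a ∷ []) → refl }
slot5C = comp-via slot5 (ap1 sndC (ap1 sndC (ap1 sndC (ap1 sndC (ap1 sndC #0))))) λ { (a ∷ []) → refl }

-- Codes of programs (see  code  below) are
--   pair 0 0 (zero), pair 1 0 (succ), pair 2 i (proj i), pair 3 (pair f gs) (comp),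
--   pair 4 (pair f g) (prim), pair 5 f (mu).
-- Machine states, with a continuation stack k (a list of frames):
--   EV c a k        evaluate code c on the argument list a;
--   RET v k         return v to the top frame of k; RET v 0 is final;
--   NX f r a acc k  evaluate the argument codes r of a composition with head f,
--                   acc holding the values already computed.
-- Frames:
--   CK f r a acc    waiting for the value of the next composition argument;
--   PK g i n xs     primitive recursion, the value at i is arriving, target n;
--   MK f i xs       unbounded search, the candidate i is being tested.
EV : ℕ → ℕ → ℕ → ℕ
EV c a k = state 0 c a k 0 0
RET : ℕ → ℕ → ℕ
RET v k = state 1 v k 0 0 0
NX : ℕ → ℕ → ℕ → ℕ → ℕ → ℕ
NX f r a acc k = state 2 f r a acc k
CK : ℕ → ℕ → ℕ → ℕ → ℕ
CK f r a acc = state 0 f r a acc 0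
PK : ℕ → ℕ → ℕ → ℕ → ℕ
PK g i n xs = state 1 g i n xs 0
MK : ℕ → ℕ → ℕ → ℕ
MK f i xs = state 2 f i xs 0 0

module StateExprs {k : ℕ} where
  stateE : Expr k → Expr k → Expr k → Expr k → Expr k → Expr k → Expr k
  stateE a b c d e f = app stateC (a ∷ b ∷ c ∷ d ∷ e ∷ f ∷ [])
  EVE : Expr k → Expr k → Expr k → Expr k
  EVE c a s = stateE (lit 0) c a s (lit 0) (lit 0)
  RETE : Expr k → Expr k → Expr k
  RETE v s = stateE (lit 1) v s (lit 0) (lit 0) (lit 0)
  NXE : Expr k → Expr k → Expr k → Expr k → Expr k → Expr k
  NXE f r a acc s = stateE (lit 2) f r a acc s
  CKE : Expr k → Expr k → Expr k → Expr k → Expr k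
  CKE f r a acc = stateE (lit 0) f r a acc (lit 0)
  PKE : Expr k → Expr k → Expr k → Expr k → Expr k
  PKE g i n xs = stateE (lit 1) g i n xs (lit 0)
  MKE : Expr k → Expr k → Expr k → Expr k
  MKE f i xs = stateE (lit 2) f i xs (lit 0) (lit 0)
  ifzE : Expr k → Expr k → Expr k → Expr k
  ifzE = ap3 ifzC
  predE sucE fstE sndE hdE tlE : Expr k → Expr k
  predE = ap1 predC
  sucE = ap1 succC
  fstE = ap1 fstC
  sndE = ap1 sndC
  hdE = ap1 hdC
  tlE = ap1 tlC
  consE nthE distE : Expr k → Expr k → Expr k
  consE = ap2 consC
  nthE = ap2 nthC
  distE = ap2 distC
open StateExprs

evalByTag : ℕ → ℕ → ℕ → ℕ → ℕ
evalByTag tag body a k =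
  ifz tag (RET 0 k) (
  ifz (pred tag) (RET (suc (hd a)) k) (
  ifz (pred (pred tag)) (RET (nth a body) k) (
  ifz (pred (pred (pred tag))) (NX (fst body) (snd body) a 0 k) (
  ifz (pred (pred (pred (pred tag))))
    (EV (fst body) (tl a) (cons (PK (snd body) 0 (hd a) (tl a)) k))
    (EV body (cons 0 a) (cons (MK body 0 a) k))))))

evalByTagC : Comp 4 (uncurryⁿ evalByTag)
evalByTagC = comp-via evalByTag
  (ifzE #0 (RETE (lit 0) #3) (
   ifzE (predE #0) (RETE (sucE (hdE #2)) #3) (
   ifzE (predE (predE #0)) (RETE (nthE #2 #1) #3) (
   ifzE (predE (predE (predE #0))) (NXE (fstE #1) (sndE #1) #2 (lit 0) #3) (
   ifzE (predE (predE (predE (predE #0))))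
     (EVE (fstE #1) (tlE #2) (consE (PKE (sndE #1) (lit 0) (hdE #2) (tlE #2)) #3))
     (EVE #1 (consE (lit 0) #2) (consE (MKE #1 (lit 0) #2) #3)))))))
  λ { (tag ∷ body ∷ a ∷ k ∷ []) → refl }

evalStep : ℕ → ℕ → ℕ → ℕ
evalStep c a k = evalByTag (fst c) (snd c) a k

evalStepC : Comp 3 (uncurryⁿ evalStep)
evalStepC = comp-via evalStep (app evalByTagC (fstE #0 ∷ sndE #0 ∷ #1 ∷ #2 ∷ [])) λ { (a ∷ b ∷ c ∷ []) → refl }

-- Returning v into a frame (tag ft, slots y1 … y4) with remaining stack rest.
popFrame : ℕ → ℕ → ℕ → ℕ → ℕ → ℕ → ℕ → ℕ
popFrame v ft y1 y2 y3 y4 rest =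
  ifz ft (NX y1 y2 y3 (cons v y4) rest) (
  ifz (pred ft)
    (ifz (dist y2 y3) (RET v rest) (EV y1 (cons y2 (cons v y4)) (cons (PK y1 (suc y2) y3 y4) rest)))
    (ifz v (RET y2 rest) (EV y1 (cons (suc y2) y3) (cons (MK y1 (suc y2) y3) rest))))

popFrameC : Comp 7 (uncurryⁿ popFrame)
popFrameC = comp-via popFrame
  (ifzE #1 (NXE #2 #3 #4 (consE #0 #5) #6) (
   ifzE (predE #1)
     (ifzE (distE #3 #4) (RETE #0 #6) (EVE #2 (consE #3 (consE #0 #5)) (consE (PKE #2 (sucE #3) #4 #5) #6)))
     (ifzE #0 (RETE #3 #6) (EVE #2 (consE (sucE #3) #4) (consE (MKE #2 (sucE #3) #4) #6)))))
  λ { (v ∷ ft ∷ y1 ∷ y2 ∷ y3 ∷ y4 ∷ rest ∷ []) → refl }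

returnStep : ℕ → ℕ → ℕ
returnStep v k = ifz k (RET v 0)
  (popFrame v (slot0 (hd k)) (slot1 (hd k)) (slot2 (hd k)) (slot3 (hd k)) (slot4 (hd k)) (tl k))

returnStepC : Comp 2 (uncurryⁿ returnStep)
returnStepC = comp-via returnStep
  (ifzE #1 (RETE #0 (lit 0)) (app popFrameC
    (#0 ∷ ap1 slot0C (hdE #1) ∷ ap1 slot1C (hdE #1) ∷ ap1 slot2C (hdE #1) ∷ ap1 slot3C (hdE #1)
        ∷ ap1 slot4C (hdE #1) ∷ tlE #1 ∷ [])))
  λ { (a ∷ b ∷ []) → refl }

argsStep : ℕ → ℕ → ℕ → ℕ → ℕ → ℕ
argsStep f r a acc k = ifz r (EV f acc k) (EV (hd r) a (cons (CK f (tl r) a acc) k))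

argsStepC : Comp 5 (uncurryⁿ argsStep)
argsStepC = comp-via argsStep (ifzE #1 (EVE #0 #3 #4) (EVE (hdE #1) #2 (consE (CKE #0 (tlE #1) #2 #3) #4)))
  λ { (a ∷ b ∷ c ∷ d ∷ e ∷ []) → refl }

stepBy : ℕ → ℕ → ℕ → ℕ → ℕ → ℕ → ℕ
stepBy t a b c d e = ifz t (evalStep a b c) (ifz (pred t) (returnStep a b) (argsStep a b c d e))

stepByC : Comp 6 (uncurryⁿ stepBy)
stepByC = comp-via stepBy
  (ifzE #0 (ap3 evalStepC #1 #2 #3) (ifzE (predE #0) (ap2 returnStepC #1 #2) (app argsStepC (#1 ∷ #2 ∷ #3 ∷ #4 ∷ #5 ∷ []))))
  λ { (t ∷ a ∷ b ∷ c ∷ d ∷ e ∷ []) → refl }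

step : ℕ → ℕ
step s = stepBy (slot0 s) (slot1 s) (slot2 s) (slot3 s) (slot4 s) (slot5 s)

stepC : Comp 1 (uncurryⁿ step)
stepC = comp-via step
  (app stepByC (ap1 slot0C #0 ∷ ap1 slot1C #0 ∷ ap1 slot2C #0 ∷ ap1 slot3C #0 ∷ ap1 slot4C #0 ∷ ap1 slot5C #0 ∷ []))
  λ { (a ∷ []) → refl }

step-state : ∀ t a b c d e → step (state t a b c d e) ≡ stepBy t a b c d e
step-state t a b c d e rewrite slot0-state t a b c d e | slot1-state t a b c d e | slot2-state t a b c d e
                             | slot3-state t a b c d e | slot4-state t a b c d e | slot5-state t a b c d e = refl

step-eval : ∀ tag body a k → step (EV (pair tag body) a k) ≡ evalByTag tag body a k
step-eval tag body a k rewrite step-state 0 (pair tag body) a k 0 0 | fst-pair tag body | snd-pair tag body = refl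

step-return : ∀ v ft y1 y2 y3 y4 y5 rest → step (RET v (cons (state ft y1 y2 y3 y4 y5) rest)) ≡ popFrame v ft y1 y2 y3 y4 rest
step-return v ft y1 y2 y3 y4 y5 rest
  rewrite step-state 1 v (cons (state ft y1 y2 y3 y4 y5) rest) 0 0 0
        | hd-cons (state ft y1 y2 y3 y4 y5) rest | tl-cons (state ft y1 y2 y3 y4 y5) rest
        | slot0-state ft y1 y2 y3 y4 y5 | slot1-state ft y1 y2 y3 y4 y5 | slot2-state ft y1 y2 y3 y4 y5
        | slot3-state ft y1 y2 y3 y4 y5 | slot4-state ft y1 y2 y3 y4 y5 = refl

step-zero : ∀ a k → step (EV (pair 0 0) a k) ≡ RET 0 k
step-zero a k = step-eval 0 0 a k

step-succ : ∀ x l k → step (EV (pair 1 0) (cons x l) k) ≡ RET (suc x) k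
step-succ x l k rewrite step-eval 1 0 (cons x l) k | hd-cons x l = refl

step-proj : ∀ i a k → step (EV (pair 2 i) a k) ≡ RET (nth a i) k
step-proj i a k = step-eval 2 i a k

step-comp : ∀ f gs a k → step (EV (pair 3 (pair f gs)) a k) ≡ NX f gs a 0 k
step-comp f gs a k rewrite step-eval 3 (pair f gs) a k | fst-pair f gs | snd-pair f gs = refl

step-prim : ∀ f g n xs k → step (EV (pair 4 (pair f g)) (cons n xs) k) ≡ EV f xs (cons (PK g 0 n xs) k)
step-prim f g n xs k
  rewrite step-eval 4 (pair f g) (cons n xs) k | fst-pair f g | snd-pair f g | hd-cons n xs | tl-cons n xs = refl

step-mu : ∀ f a k → step (EV (pair 5 f) a k) ≡ EV f (cons 0 a) (cons (MK f 0 a) k)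
step-mu f a k = step-eval 5 f a k

step-final : ∀ v → step (RET v 0) ≡ RET v 0
step-final v = step-state 1 v 0 0 0 0

step-args-nil : ∀ f a acc k → step (NX f 0 a acc k) ≡ EV f acc k
step-args-nil f a acc k = step-state 2 f 0 a acc k

step-args-cons : ∀ f g r a acc k → step (NX f (cons g r) a acc k) ≡ EV g a (cons (CK f r a acc) k)
step-args-cons f g r a acc k rewrite step-state 2 f (cons g r) a acc k | hd-cons g r | tl-cons g r = refl

step-ck : ∀ v f r a acc k → step (RET v (cons (CK f r a acc) k)) ≡ NX f r a (cons v acc) k
step-ck v f r a acc k = step-return v 0 f r a acc 0 k

step-pk-done : ∀ v g n xs k → step (RET v (cons (PK g n n xs) k)) ≡ RET v k
step-pk-done v g n xs k rewrite step-return v 1 g n n xs 0 k | dist-self n = refl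

step-pk-next : ∀ v g i n xs k → ¬ (i ≡ n) →
               step (RET v (cons (PK g i n xs) k)) ≡ EV g (cons i (cons v xs)) (cons (PK g (suc i) n xs) k)
step-pk-next v g i n xs k i≢n rewrite step-return v 1 g i n xs 0 k = ifz-dist-≢ i n _ _ i≢n

step-mk-found : ∀ f i xs k → step (RET 0 (cons (MK f i xs) k)) ≡ RET i k
step-mk-found f i xs k = step-return 0 2 f i xs 0 0 k

step-mk-next : ∀ v f i xs k → step (RET (suc v) (cons (MK f i xs) k)) ≡ EV f (cons (suc i) xs) (cons (MK f (suc i) xs) k)
step-mk-next v f i xs k = step-return (suc v) 2 f i xs 0 0 k

∸∸≡⊓ : ∀ m n → m ∸ (m ∸ n) ≡ m ⊓ n
∸∸≡⊓ m n with ≤-total n m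
... | inj₁ n≤m = trans (m∸[m∸n]≡n n≤m) (sym (m≥n⇒m⊓n≡n n≤m))
... | inj₂ m≤n = trans (cong (m ∸_) (m≤n⇒m∸n≡0 m≤n)) (sym (m≤n⇒m⊓n≡m m≤n))

minC : Comp 2 (uncurryⁿ _⊓_)
minC = comp-via _⊓_ (ap2 subC #0 (ap2 subC #0 #1)) λ { (m ∷ n ∷ []) → ∸∸≡⊓ m n }

run : ℕ → ℕ → ℕ
run zero s = s
run (suc t) s = run t (step s)

run-+ : ∀ a b s → run (a + b) s ≡ run b (run a s)
run-+ zero b s = refl
run-+ (suc a) b s = run-+ a b (step s)

run-suc : ∀ t s → run (suc t) s ≡ step (run t s)
run-suc zero s = refl
run-suc (suc t) s = run-suc t (step s)

Reach : ℕ → ℕ → Set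
Reach s s' = Σ ℕ λ t → run t s ≡ s'

reach-refl : ∀ {s} → Reach s s
reach-refl = 0 , refl

reach-step : ∀ {s s'} → step s ≡ s' → Reach s s'
reach-step e = 1 , e

infixr 5 _▸_
_▸_ : ∀ {s s' s''} → Reach s s' → Reach s' s'' → Reach s s''
(a , p) ▸ (b , q) = a + b , trans (run-+ a b _) (trans (cong (run b) p) q)

-- Gödel numbering of programs; the argument codes of a composition are stored in reverse.
mutual
  code : ∀ {k} → PR k → ℕ
  code zeroF = pair 0 0
  code succF = pair 1 0
  code (proj i) = pair 2 (toℕ i)
  code (comp f gs) = pair 3 (pair (code f) (codeArgs gs 0))
  code (prim f g) = pair 4 (pair (code f) (code g))
  code (mu f) = pair 5 (code f)

  codeArgs : ∀ {k m} → Vec (PR k) m → ℕ → ℕ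
  codeArgs [] r = r
  codeArgs (g ∷ gs) r = codeArgs gs (cons (code g) r)

mutual
  simulate : ∀ {k} {c : PR k} {xs v} → Eval c xs v → ∀ stk → Reach (EV (code c) (encode xs) stk) (RET v stk)
  simulate (ev-zero {x}) stk = reach-step (step-zero _ stk)
  simulate (ev-succ {x}) stk = reach-step (step-succ x 0 stk)
  simulate (ev-proj {i = i} {xs}) stk =
    reach-step (trans (step-proj (toℕ i) (encode xs) stk) (cong (λ z → RET z stk) (nth-encode xs i)))
  simulate (ev-comp {f = f} {gs} {xs} da df) stk =
    reach-step (step-comp (code f) (codeArgs gs 0) (encode xs) stk)
    ▸ simulateArgs da (code f) 0 0 stk ▸ reach-step (step-args-nil _ _ _ _) ▸ simulate df stk
  simulate d@(ev-prim0 {f = f} {g} {xs} _) stk =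
    reach-step (step-prim (code f) (code g) 0 (encode xs) stk)
    ▸ simulatePrim d ≤-refl stk ▸ reach-step (step-pk-done _ _ _ _ _)
  simulate d@(ev-primS {f = f} {g} {n} {xs} _ _) stk =
    reach-step (step-prim (code f) (code g) (suc n) (encode xs) stk)
    ▸ simulatePrim d ≤-refl stk ▸ reach-step (step-pk-done _ _ _ _ _)
  simulate (ev-mu {f = f} {xs} {n} found earlier) stk =
    reach-step (step-mu (code f) (encode xs) stk)
    ▸ simulateSearch earlier n ≤-refl stk ▸ simulate found _ ▸ reach-step (step-mk-found _ _ _ _)

  simulateArgs : ∀ {k m} {gs : Vec (PR k) m} {xs ys} → EvalAll gs xs ys → ∀ f rest acc stk →
    Reach (NX f (codeArgs gs rest) (encode xs) acc stk) (NX f rest (encode xs) (encodeOnto ys acc) stk)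
  simulateArgs ea-[] f rest acc stk = reach-refl
  simulateArgs (ea-∷ {g = g} dg dgs) f rest acc stk =
    simulateArgs dgs f (cons (code g) rest) acc stk
    ▸ reach-step (step-args-cons _ _ _ _ _ _) ▸ simulate dg _ ▸ reach-step (step-ck _ _ _ _ _ _)

  simulatePrim : ∀ {k} {f : PR k} {g i xs r n} → Eval (prim f g) (i ∷ xs) r → i ≤ n → ∀ stk →
    Reach (EV (code f) (encode xs) (cons (PK (code g) 0 n (encode xs)) stk))
          (RET r (cons (PK (code g) i n (encode xs)) stk))
  simulatePrim (ev-prim0 df) i≤n stk = simulate df _
  simulatePrim {g = g} {xs = xs} {n = n} (ev-primS {n = i} {r = r'} dp dg) i<n stk =
    simulatePrim dp (≤-trans (n≤1+n i) i<n) stk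
    ▸ reach-step (step-pk-next r' (code g) i n (encode xs) stk (<⇒≢ i<n)) ▸ simulate dg _

  simulateSearch : ∀ {k} {f : PR (suc k)} {xs n} → (∀ i → i < n → Σ ℕ (λ v → Eval f (i ∷ xs) (suc v))) →
    ∀ j → j ≤ n → ∀ stk →
    Reach (EV (code f) (cons 0 (encode xs)) (cons (MK (code f) 0 (encode xs)) stk))
          (EV (code f) (cons j (encode xs)) (cons (MK (code f) j (encode xs)) stk))
  simulateSearch earlier zero j≤n stk = reach-refl
  simulateSearch earlier (suc j) j<n stk =
    simulateSearch earlier j (≤-trans (n≤1+n j) j<n) stk ▸ simulateMiss (earlier j j<n) stk

  simulateMiss : ∀ {k} {f : PR (suc k)} {xs j} → Σ ℕ (λ v → Eval f (j ∷ xs) (suc v)) → ∀ stk →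
    Reach (EV (code f) (cons j (encode xs)) (cons (MK (code f) j (encode xs)) stk))
          (EV (code f) (cons (suc j) (encode xs)) (cons (MK (code f) (suc j) (encode xs)) stk))
  simulateMiss (v , d) stk = simulate d _ ▸ reach-step (step-mk-next _ _ _ _ _)

-- finalDist s vanishes exactly on the final states  RET v 0 .
finalDist : ℕ → ℕ
finalDist s = dist s (RET (slot1 s) 0)

finalDistC : Comp 1 (uncurryⁿ finalDist)
finalDistC = comp-via finalDist (distE #0 (RETE (ap1 slot1C #0) (lit 0))) λ { (a ∷ []) → refl }

-- Clocked runs.  A configuration  pair c s  records the state s and the number c of
-- steps taken; a tick advances both unless s is final, after which nothing changes.
Halted : ℕ → Set
Halted p = finalDist (snd p) ≡ 0

halted? : ∀ p → Halted p ⊎ ¬ Halted p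
halted? p with finalDist (snd p)
... | zero = inj₁ refl
... | suc _ = inj₂ (λ ())

tick : ℕ → ℕ
tick p = ifz (finalDist (snd p)) p (pair (suc (fst p)) (step (snd p)))

tickC : Comp 1 (uncurryⁿ tick)
tickC = comp-via tick
  (ifzE (ap1 finalDistC (sndE #0)) #0 (ap2 pairC (sucE (fstE #0)) (ap1 stepC (sndE #0))))
  λ { (a ∷ []) → refl }

tick-halted : ∀ p → Halted p → tick p ≡ p
tick-halted p h rewrite h = refl

tick-running : ∀ p → ¬ Halted p → tick p ≡ pair (suc (fst p)) (step (snd p))
tick-running p nh with finalDist (snd p)
... | zero = ⊥-elim (nh refl)
... | suc _ = refl

-- The state component follows the machine: a final state is a fixed point of step.
snd-tick : ∀ p → snd (tick p) ≡ step (snd p)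
snd-tick p with halted? p
... | inj₂ nh rewrite tick-running p nh = snd-pair _ _
... | inj₁ h rewrite tick-halted p h =
  let final = dist≡0⇒≡ _ _ h in trans final (trans (sym (step-final (slot1 (snd p)))) (cong step (sym final)))

clocked : ℕ → ℕ → ℕ
clocked zero p = p
clocked (suc l) p = tick (clocked l p)

clockedC : Comp 2 (uncurryⁿ clocked)
clockedC = comp-ext (prim-comp (proj-comp fz) (expr-comp (ap1 tickC #1))) clocked-eq
  where
  clocked-eq : ∀ xs → _ ≡ _
  clocked-eq (zero ∷ p ∷ []) = refl
  clocked-eq (suc l ∷ p ∷ []) = cong tick (clocked-eq (l ∷ p ∷ []))

snd-clocked : ∀ l p → snd (clocked l p) ≡ run l (snd p)
snd-clocked zero p = refl
snd-clocked (suc l) p = trans (snd-tick (clocked l p)) (trans (cong step (snd-clocked l p)) (sym (run-suc l (snd p))))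

clocked-frozen : ∀ l p → Halted (clocked l p) → ∀ l' → l ≤ l' → clocked l' p ≡ clocked l p
clocked-frozen l p h l' l≤l' = trans (cong (λ z → clocked z p) (sym (m∸n+n≡m l≤l'))) (frozen (l' ∸ l))
  where
  frozen : ∀ j → clocked (j + l) p ≡ clocked l p
  frozen zero = refl
  frozen (suc j) rewrite frozen j = tick-halted _ h

-- Starting from clock 0, the clock at stage l reads l while the run is going; once
-- halted it reads the halting time, at which the final configuration was reached.
clock-reading : ∀ p → fst p ≡ 0 → ∀ l →
  fst (clocked l p) ≡ l ⊎ (Halted (clocked l p) × clocked (fst (clocked l p)) p ≡ clocked l p)
clock-reading p fst≡0 zero = inj₁ fst≡0
clock-reading p fst≡0 (suc l) with clock-reading p fst≡0 l
... | inj₂ (h , eq) rewrite tick-halted (clocked l p) h = inj₂ (h , eq)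
... | inj₁ eq with halted? (clocked l p)
...   | inj₁ h rewrite tick-halted (clocked l p) h = inj₂ (h , cong (λ z → clocked z p) eq)
...   | inj₂ nh rewrite tick-running (clocked l p) nh = inj₁ (trans (fst-pair _ _) (cong suc eq))

halted-at-clock : ∀ p → fst p ≡ 0 → ∀ l → Halted (clocked l p) → clocked (fst (clocked l p)) p ≡ clocked l p
halted-at-clock p fst≡0 l h with clock-reading p fst≡0 l
... | inj₁ eq = cong (λ z → clocked z p) eq
... | inj₂ (_ , eq) = eq

reading : ℕ → ℕ
reading p = ifz (finalDist (snd p)) (fst p + slot1 (snd p)) 0

readingC : Comp 1 (uncurryⁿ reading)
readingC = comp-via reading
  (ifzE (ap1 finalDistC (sndE #0)) (ap2 addC (fstE #0) (ap1 slot1C (sndE #0))) (lit 0))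
  λ { (a ∷ []) → refl }

reading-halted : ∀ p → Halted p → reading p ≡ fst p + slot1 (snd p)
reading-halted p h rewrite h = refl

reading-running : ∀ p → ¬ Halted p → reading p ≡ 0
reading-running p nh with finalDist (snd p)
... | zero = ⊥-elim (nh refl)
... | suc _ = refl

start : ℕ → ℕ → ℕ
start e x = pair 0 (EV e (cons x 0) 0)

approx : ℕ → ℕ → ℕ → ℕ
approx e x l = reading (clocked l (start e x))

approxC : Comp 3 (uncurryⁿ approx)
approxC = comp-via approx
  (ap1 readingC (ap2 clockedC #2 (ap2 pairC (lit 0) (EVE #0 (consE #1 (lit 0)) (lit 0)))))
  λ { (a ∷ b ∷ c ∷ []) → refl }

record Settling (s : ℕ → ℕ) : Set where
  field
    zero-or-final : ∀ l → s l ≡ 0 ⊎ (∀ l' → l ≤ l' → s l' ≡ s l)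
    on-time       : ∀ l → 0 < s l → s (s l) ≡ s l

module _ {s : ℕ → ℕ} (S : Settling s) where
  open Settling S

  final-if-positive : ∀ t → 0 < s t → ∀ l → t ≤ l → s l ≡ s t
  final-if-positive t pos with zero-or-final t
  ... | inj₁ vanishes = ⊥-elim (<⇒≢ pos (sym vanishes))
  ... | inj₂ final = final

  settling-mono : ∀ l → s l ≤ s (suc l)
  settling-mono l with zero-or-final l
  ... | inj₁ vanishes rewrite vanishes = z≤n
  ... | inj₂ final = ≤-reflexive (sym (final (suc l) (n≤1+n l)))

-- The approximations of a program run settle: once halted the reading is frozen.
approx-settling : ∀ e x → Settling (approx e x)
approx-settling e x = record { zero-or-final = zero-or-final ; on-time = on-time }
  where
  P : ℕ
  P = start e x
  clock0 : fst P ≡ 0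
  clock0 = fst-pair 0 _

  zero-or-final : ∀ l → approx e x l ≡ 0 ⊎ (∀ l' → l ≤ l' → approx e x l' ≡ approx e x l)
  zero-or-final l with halted? (clocked l P)
  ... | inj₁ h = inj₂ λ l' l≤l' → cong reading (clocked-frozen l P h l' l≤l')
  ... | inj₂ nh = inj₁ (reading-running _ nh)

  -- A positive reading c + v is taken at or after the halting time c.
  on-time : ∀ l → 0 < approx e x l → approx e x (approx e x l) ≡ approx e x l
  on-time l pos with halted? (clocked l P)
  ... | inj₂ nh = ⊥-elim (<⇒≢ pos (sym (reading-running _ nh)))
  ... | inj₁ h = cong reading (trans (clocked-frozen c P h-c (approx e x l) c≤reading) at-clock)
    where
    c : ℕ
    c = fst (clocked l P)
    at-clock : clocked c P ≡ clocked l P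
    at-clock = halted-at-clock P clock0 l h
    h-c : Halted (clocked c P)
    h-c = subst Halted (sym at-clock) h
    c≤reading : c ≤ approx e x l
    c≤reading = subst (c ≤_) (sym (reading-halted _ h)) (m≤m+n c _)

approx-sees-output : ∀ (c : PR 1) x v → Eval c (x ∷ []) v → ∃ λ t → v ≤ approx (code c) x t
approx-sees-output c x v d with simulate d 0
... | (t , reaches) = t , v≤reading
  where
  P : ℕ
  P = start (code c) x
  final : snd (clocked t P) ≡ RET v 0
  final = trans (snd-clocked t P) (trans (cong (run t) (snd-pair 0 _)) reaches)
  out : slot1 (snd (clocked t P)) ≡ v
  out = trans (cong slot1 final) (slot1-state 1 v 0 0 0 0)
  halted : Halted (clocked t P)
  halted rewrite final | slot1-state 1 v 0 0 0 0 = dist-self (RET v 0)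
  open ≤-Reasoning
  v≤reading : v ≤ approx (code c) x t
  v≤reading = begin
    v                                               ≤⟨ m≤n+m v _ ⟩
    fst (clocked t P) + v                           ≡⟨ cong (fst (clocked t P) +_) (sym out) ⟩
    fst (clocked t P) + slot1 (snd (clocked t P))   ≡⟨ reading-halted _ halted ⟨
    approx (code c) x t                             ∎

-- With excluded middle, every sequence has a "limit": some positive value if there is one, else 0.
-- For settling sequences this is a genuine limit, reached from stage (limit s) on.
module Limit (em : ExcludedMiddle 0ℓ) where
  limit : (ℕ → ℕ) → ℕ
  limit s with em {∃ λ t → 0 < s t}
  ... | yes (t , _) = s t
  ... | no _ = 0

  all-zero : ∀ {s : ℕ → ℕ} → ¬ (∃ λ t → 0 < s t) → ∀ l → s l ≡ 0
  all-zero none l = n≤0⇒n≡0 (≮⇒≥ (λ pos → none (l , pos)))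

  below-limit : ∀ {s} → Settling s → ∀ l → s l ≤ limit s
  below-limit {s} S l with em {∃ λ t → 0 < s t}
  ... | no none = ≤-reflexive (all-zero none l)
  ... | yes (t , pos) with Settling.zero-or-final S l
  ...   | inj₁ vanishes = subst (_≤ s t) (sym vanishes) z≤n
  ...   | inj₂ final = ≤-reflexive (trans (sym (final (t + l) (m≤n+m l t)))
                                           (final-if-positive S t pos (t + l) (m≤m+n t l)))

  reaches-limit : ∀ {s} → Settling s → ∀ l → limit s ≤ l → s l ≡ limit s
  reaches-limit {s} S l lim≤l with em {∃ λ t → 0 < s t}
  ... | no none = all-zero none l
  ... | yes (t , pos) = trans (final-if-positive S (s t) pos′ l lim≤l) on-time
    where
    on-time : s (s t) ≡ s t
    on-time = Settling.on-time S t pos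
    pos′ : 0 < s (s t)
    pos′ = subst (0 <_) (sym on-time) pos

sumTo : (ℕ → ℕ) → ℕ → ℕ
sumTo f zero = 0
sumTo f (suc j) = sumTo f j + f j

sumTo-mono : ∀ f g n → (∀ i → i < n → f i ≤ g i) → sumTo f n ≤ sumTo g n
sumTo-mono f g zero f≤g = z≤n
sumTo-mono f g (suc n) f≤g = +-mono-≤ (sumTo-mono f g n (λ i i<n → f≤g i (m≤n⇒m≤1+n i<n))) (f≤g n ≤-refl)

sumTo-cong : ∀ f g n → (∀ i → i < n → f i ≡ g i) → sumTo f n ≡ sumTo g n
sumTo-cong f g zero f≡g = refl
sumTo-cong f g (suc n) f≡g = cong₂ _+_ (sumTo-cong f g n (λ i i<n → f≡g i (m≤n⇒m≤1+n i<n))) (f≡g n ≤-refl)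

sumTo-suc : ∀ f n → sumTo f n ≤ sumTo f (suc n)
sumTo-suc f n = m≤m+n (sumTo f n) (f n)

term≤sumTo : ∀ f i n → i < n → f i ≤ sumTo f n
term≤sumTo f i (suc n) (s≤s i≤n) with m≤n⇒m<n∨m≡n i≤n
... | inj₁ i<n = ≤-trans (term≤sumTo f i n i<n) (sumTo-suc f n)
... | inj₂ refl = m≤n+m (f i) (sumTo f i)

square : (ℕ → ℕ → ℕ) → ℕ → ℕ
square f n = sumTo (λ e → sumTo (f e) (suc n)) (suc n)

square-mono : ∀ f g n → (∀ e x → f e x ≤ g e x) → square f n ≤ square g n
square-mono f g n f≤g = sumTo-mono _ _ (suc n) λ e _ → sumTo-mono _ _ (suc n) λ x _ → f≤g e x

square-cong : ∀ f g n → (∀ e x → e ≤ n → x ≤ n → f e x ≡ g e x) → square f n ≡ square g n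
square-cong f g n f≡g = sumTo-cong _ _ (suc n) λ e e≤n → sumTo-cong _ _ (suc n) λ x x≤n →
  f≡g e x (≤-pred e≤n) (≤-pred x≤n)

entry≤square : ∀ f e x n → e ≤ n → x ≤ n → f e x ≤ square f n
entry≤square f e x n e≤n x≤n =
  ≤-trans (term≤sumTo (f e) x (suc n) (s≤s x≤n)) (term≤sumTo (λ e → sumTo (f e) (suc n)) e (suc n) (s≤s e≤n))

square-suc : ∀ f n → square f n ≤ square f (suc n)
square-suc f n = ≤-trans (sumTo-mono _ _ (suc n) λ e _ → sumTo-suc (f e) (suc n))
                         (sumTo-suc (λ e → sumTo (f e) (suc (suc n))) (suc n))

squareC : ∀ {f : ℕ → ℕ → ℕ → ℕ} → Comp 3 (uncurryⁿ f) →
          Comp 2 (uncurryⁿ (λ n l → square (λ e x → f e x l) n))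
squareC {f} fC = comp-via (λ n l → square (λ e x → f e x l) n) (ap3 outerC (sucE #0) (sucE #0) #1)
  λ { (n ∷ l ∷ []) → refl }
  where
  innerC : Comp 3 (uncurryⁿ (λ xb e l → sumTo (λ x → f e x l) xb))
  innerC = comp-ext (prim-comp (expr-comp (lit 0)) (expr-comp (ap2 addC #1 (ap3 fC #2 #0 #3)))) inner-eq
    where
    inner-eq : ∀ xs → _ ≡ _
    inner-eq (zero ∷ e ∷ l ∷ []) = refl
    inner-eq (suc j ∷ e ∷ l ∷ []) = cong (_+ f e j l) (inner-eq (j ∷ e ∷ l ∷ []))
  outerC : Comp 3 (uncurryⁿ (λ eb xb l → sumTo (λ e → sumTo (λ x → f e x l) xb) eb))
  outerC = comp-ext (prim-comp (expr-comp (lit 0)) (expr-comp (ap2 addC #1 (ap3 innerC #2 #0 #3)))) outer-eq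
    where
    outer-eq : ∀ xs → _ ≡ _
    outer-eq (zero ∷ xb ∷ l ∷ []) = refl
    outer-eq (suc j ∷ xb ∷ l ∷ []) = cong (_+ sumTo (λ x → f j x l) xb) (outer-eq (j ∷ xb ∷ l ∷ []))

step-increasing : ∀ (f : ℕ → ℕ) → (∀ n → f n < f (suc n)) → StrictlyIncreasing f
step-increasing f inc m (suc n) (s≤s m≤n) with m≤n⇒m<n∨m≡n m≤n
... | inj₁ m<n = <-trans (step-increasing f inc m n m<n) (inc n)
... | inj₂ refl = inc m

module Construction (em : ExcludedMiddle 0ℓ) where
  open Limit em

  lim : ℕ → ℕ → ℕ
  lim e x = limit (approx e x)

  θ : ℕ → ℕ
  θ n = suc n + square lim n

  ψ : ℕ → ℕ → ℕ
  ψ n l = suc n + square (λ e x → approx e x l) n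

  φ : ℕ → ℕ → ℕ
  φ n l = l ⊓ ψ n l

  φ-computable : Computable₂ φ
  φ-computable = proj₁ φC , λ n l → proj₂ φC (n ∷ l ∷ [])
    where
    φC : Comp 2 (uncurryⁿ φ)
    φC = comp-via φ (ap2 minC #1 (ap2 addC (sucE #0) (ap2 (squareC approxC) #0 #1)))
      λ { (n ∷ l ∷ []) → refl }

  ψ≤θ : ∀ n l → ψ n l ≤ θ n
  ψ≤θ n l = +-monoʳ-≤ (suc n) (square-mono _ _ n λ e x → below-limit (approx-settling e x) l)

  ψ-mono : ∀ n l → ψ n l ≤ ψ n (suc l)
  ψ-mono n l = +-monoʳ-≤ (suc n) (square-mono _ _ n λ e x → settling-mono (approx-settling e x) l)

  -- From stage θ n on, every summand of ψ n has reached its limit.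
  ψ-reaches-θ : ∀ n l → θ n ≤ l → ψ n l ≡ θ n
  ψ-reaches-θ n l θ≤l = cong (suc n +_) (square-cong _ _ n λ e x e≤n x≤n →
    reaches-limit (approx-settling e x) l
      (≤-trans (entry≤square lim e x n e≤n x≤n) (≤-trans (m≤n+m (square lim n) (suc n)) θ≤l)))

  θ-increasing : StrictlyIncreasing θ
  θ-increasing = step-increasing θ λ n → s≤s (s≤s (+-monoʳ-≤ n (square-suc lim n)))

  -- A computable Γ computed by c satisfies Γ n ≤ lim (code c) n, which is a summand
  -- of θ n as soon as n ≥ code c.
  θ-dominates : DominatesComputable θ
  θ-dominates Γ (c , computes) = code c , λ n c≤n → s≤s (Γ≤ n c≤n)
    where
    open ≤-Reasoning
    Γ≤ : ∀ n → code c ≤ n → Γ n ≤ n + square lim n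
    Γ≤ n c≤n with approx-sees-output c n (Γ n) (computes n)
    ... | (t , Γn≤approx) = begin
      Γ n                  ≤⟨ Γn≤approx ⟩
      approx (code c) n t  ≤⟨ below-limit (approx-settling (code c) n) t ⟩
      lim (code c) n       ≤⟨ entry≤square lim (code c) n n c≤n ≤-refl ⟩
      square lim n         ≤⟨ m≤n+m (square lim n) n ⟩
      n + square lim n     ∎

  φ≤l : ∀ n l → φ n l ≤ l
  φ≤l n l = m⊓n≤m l (ψ n l)

  φ-mono : ∀ n l → φ n l ≤ φ n (suc l)
  φ-mono n l = ⊓-mono-≤ (n≤1+n l) (ψ-mono n l)

  φ-bounded : ∀ n l → φ n l ≤ θ n
  φ-bounded n l = ≤-trans (m⊓n≤n l (ψ n l)) (ψ≤θ n l)

  φ-reaches-θ : ∀ n l → θ n ≤ l → φ n l ≡ θ n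
  φ-reaches-θ n l θ≤l rewrite ψ-reaches-θ n l θ≤l = m≥n⇒m⊓n≡n θ≤l

theorem3 : ExcludedMiddle 0ℓ →
    Σ (ℕ → ℕ → ℕ) (λ φ →
      Computable₂ φ
      × (∀ n l → φ n l ≤ l)
      × (∀ n → φ n 0 ≡ 0 × φ n 1 ≡ 1 × (∀ l → φ n (suc l) ≤ φ n (suc (suc l))))
      × (∀ n → ∃ (λ B → ∀ l → φ n l ≤ B))
      × Σ (ℕ → ℕ) (λ θ →
          (∀ n → IsLimit (φ n) (θ n))
          × (∀ n → 1 ≤ θ n)
          × StrictlyIncreasing θ
          × DominatesComputable θ
          × (∀ n → φ n (θ n ∸ 1) < θ n × (∀ l → θ n ≤ l → φ n l ≡ θ n))))
-- φ n 0 = 0 and φ n 1 = 1 hold by computation (ψ n l ≥ 1), and θ n ∸ 1 < θ n since θ n ≥ 1.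
theorem3 em =
  φ , φ-computable , φ≤l , (λ n → refl , refl , λ l → φ-mono n (suc l)) , (λ n → θ n , φ-bounded n) ,
  θ , (λ n → θ n , φ-reaches-θ n) , (λ n → s≤s z≤n) , θ-increasing , θ-dominates ,
  (λ n → s≤s (φ≤l n (θ n ∸ 1)) , φ-reaches-θ n)
  where open Construction em
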